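{- Let $m$ be an even integer. If $m$ is not represented by $x^2+2y^2+3z^2$, then $4m$ is not represented by $x^2+2y^2+3z^2$.
   Context: An integer $n$ is represented by a form $Q(x,y,z)$ if there exist integers $x,y,z$ with $Q(x,y,z)=n$. -}

module Defs where

open import Data.Integer using (ℤ; +_; _+_; _*_)
open import Data.Product using (∃-syntax)
open import Relation.Binary.PropositionalEquality using (_≡_)

Q : ℤ → ℤ → ℤ → ℤ
Q x y z = x * x + (+ 2) * (y * y) + (+ 3) * (z * z)

RepresentedByQ : ℤ → Set
RepresentedByQ n = ∃[ x ] ∃[ y ] ∃[ z ] Q x y z ≡ n

{-# OPTIONS --safe #-}
module Submission where

-- Modulo 8 the value of x² + 2y² + 3z² depends only on x, y, z modulo 4, and
-- running through the 64 residues shows that it vanishes only when x, y, z are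
-- all even.  So if Q(x,y,z) = 4m with m even, then x, y, z are even and
-- Q(x/2, y/2, z/2) = m.

open import Defs
open import Data.Integer using (ℤ; +_; _+_; _*_)
open import Data.Integer.Divisibility using (_∣_)
open import Data.Integer.Divisibility.Signed as Signed
  using (divides; ∣ᵤ⇒∣; _∣?_; ∣m∣n⇒∣m+n; ∣n⇒∣m*n; ∣m+n∣n⇒∣m; *-monoʳ-∣)
open import Data.Integer.DivMod using (_/_; a≡a%n+[a/n]*n; n%d<d)
open import Data.Integer.Properties using (*-cancelˡ-≡)
open import Data.Integer.Tactic.RingSolver using (solve-∀)
open import Data.Fin using (Fin; toℕ; fromℕ<)
open import Data.Fin.Properties using (all?; toℕ-fromℕ<)
open import Data.Product using (∃-syntax; _×_; _,_)
open import Data.Unit using (tt)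
open import Relation.Nullary using (¬_)
open import Relation.Nullary.Decidable using (toWitness; _×-dec_; _→-dec_)
open import Relation.Binary.PropositionalEquality using (_≡_; refl; sym; trans; cong; subst)

residue : Fin 4 → ℤ
residue r = + toℕ r

division-by-4 : ∀ x → ∃[ r ] ∃[ q ] x ≡ residue r + q * + 4
division-by-4 x = fromℕ< (n%d<d x (+ 4)) , x / + 4 ,
  trans (a≡a%n+[a/n]*n x (+ 4)) (cong (λ n → + n + x / + 4 * + 4) (sym (toℕ-fromℕ< _)))

Q-shift-by-4 : ∀ r s t a b c →
  ∃[ k ] Q (r + a * + 4) (s + b * + 4) (t + c * + 4) ≡ Q r s t + k * + 8
Q-shift-by-4 r s t a b c =
  a * r + + 2 * (a * a) + + 2 * (b * s) + + 4 * (b * b) + + 3 * (c * t) + + 6 * (c * c) ,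
  identity r s t a b c
  where
  identity : ∀ r s t a b c →
    (r + a * + 4) * (r + a * + 4) + + 2 * ((s + b * + 4) * (s + b * + 4)) + + 3 * ((t + c * + 4) * (t + c * + 4)) ≡
    (r * r + + 2 * (s * s) + + 3 * (t * t)) +
    (a * r + + 2 * (a * a) + + 2 * (b * s) + + 4 * (b * b) + + 3 * (c * t) + + 6 * (c * c)) * + 8
  identity = solve-∀

Q-double : ∀ a b c → Q (a * + 2) (b * + 2) (c * + 2) ≡ + 4 * Q a b c
Q-double = identity
  where
  identity : ∀ a b c →
    a * + 2 * (a * + 2) + + 2 * (b * + 2 * (b * + 2)) + + 3 * (c * + 2 * (c * + 2)) ≡
    + 4 * (a * a + + 2 * (b * b) + + 3 * (c * c))
  identity = solve-∀

Q-residues-≡0-mod-8 : ∀ r s t →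
  + 8 Signed.∣ Q (residue r) (residue s) (residue t) →
  + 2 Signed.∣ residue r × + 2 Signed.∣ residue s × + 2 Signed.∣ residue t
Q-residues-≡0-mod-8 = toWitness {a? = all? λ r → all? λ s → all? λ t →
  (+ 8 ∣? Q (residue r) (residue s) (residue t)) →-dec
  (+ 2 ∣? residue r ×-dec + 2 ∣? residue s ×-dec + 2 ∣? residue t)} tt

even-residue⇒even : ∀ r q → + 2 Signed.∣ residue r → + 2 Signed.∣ residue r + q * + 4
even-residue⇒even r q 2∣r = ∣m∣n⇒∣m+n 2∣r (∣n⇒∣m*n q (divides (+ 2) refl))

Q≡0-mod-8⇒even : ∀ x y z → + 8 Signed.∣ Q x y z →
  + 2 Signed.∣ x × + 2 Signed.∣ y × + 2 Signed.∣ z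
Q≡0-mod-8⇒even x y z 8∣Q with division-by-4 x | division-by-4 y | division-by-4 z
... | r , a , refl | s , b , refl | t , c , refl =
  -- a `with` on this call instead makes the type checker run out of memory
  let 2∣r , 2∣s , 2∣t = Q-residues-≡0-mod-8 r s t 8∣Q-residues
  in  even-residue⇒even r a 2∣r , even-residue⇒even s b 2∣s , even-residue⇒even t c 2∣t
  where
  8∣Q-residues : + 8 Signed.∣ Q (residue r) (residue s) (residue t)
  8∣Q-residues =
    let k , shift = Q-shift-by-4 (residue r) (residue s) (residue t) a b c
    in  ∣m+n∣n⇒∣m (subst (+ 8 Signed.∣_) shift 8∣Q) (divides k refl)

represents-4n⇒represents-n : ∀ n → + 2 Signed.∣ n → RepresentedByQ (+ 4 * n) → RepresentedByQ n
represents-4n⇒represents-n n 2∣n (x , y , z , Q≡4n)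
  with Q≡0-mod-8⇒even x y z (subst (+ 8 Signed.∣_) (sym Q≡4n) (*-monoʳ-∣ (+ 4) 2∣n))
... | divides a refl , divides b refl , divides c refl =
  a , b , c , *-cancelˡ-≡ (+ 4) _ _ (trans (sym (Q-double a b c)) Q≡4n)

mainTheorem11 : (m : ℤ) → (+ 2) ∣ m → ¬ RepresentedByQ m → ¬ RepresentedByQ ((+ 4) * m)
mainTheorem11 m 2∣m m-unrepresented 4m-represented =
  m-unrepresented (represents-4n⇒represents-n m (∣ᵤ⇒∣ 2∣m) 4m-represented)
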